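{- Let $p\ge2$, $k\ge0$, $v_0,w_1,v_1,\dots,w_k,v_k\in\Sigma_p^*$, and $L=v_0w_1^*v_1\cdots v_{k-1}w_k^*v_k$. Then $[\![L]\!]_p$ is definable in existential Büchi arithmetic of base $p$.
   Context: $\Sigma_p=\{0,\dots,p-1\}$; for $w=u_m\cdots u_0\in\Sigma_p^*$, $[\![w]\!]_p=\sum_iu_ip^i$ (most significant digit first), and $[\![L]\!]_p=\{[\![w]\!]_p:w\in L\}$. Büchi arithmetic of base $p$ is the first-order theory of $\langle\mathbb{N},0,1,+,V_p\rangle$, where $V_p(a,b)$ holds iff $a$ is the largest power of $p$ dividing $b$, and $V_p(a,0)$ never holds. A set $M\subseteq\mathbb{N}$ is definable in existential Büchi arithmetic if $M=\{m:\Phi(m)\text{ holds}\}$ for some existential formula $\Phi(x)$. -}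

module Defs where

open import Data.Nat using (ℕ; zero; suc; _+_; _*_; _^_; _≤_)
open import Data.Nat.Divisibility using (_∣_)
open import Data.Fin using (Fin; toℕ)
open import Data.List using (List; []; _∷_; _++_; foldl)
open import Data.Product using (Σ; ∃; _×_; _,_)
open import Data.Sum using (_⊎_)
open import Data.Empty using (⊥)
open import Relation.Nullary using (¬_)
open import Relation.Binary.PropositionalEquality using (_≡_; _≢_)
open import Function.Bundles using (_⇔_)

Word : ℕ → Set
Word p = List (Fin p)

val : (p : ℕ) → Word p → ℕ
val p = foldl (λ acc d → acc * p + toℕ d) 0

pow : {p : ℕ} → Word p → ℕ → Word p
pow w zero    = []
pow w (suc n) = w ++ pow w n

-- Language  w₁^* v₁ w₂^* v₂ ⋯ w_k^* v_k  given by the list [(w₁,v₁),…,(w_k,v_k)]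
InStars : {p : ℕ} → List (Word p × Word p) → Word p → Set
InStars []             u = u ≡ []
InStars ((w , v) ∷ ps) u =
  Σ ℕ λ n → Σ (Word _) λ u′ → (u ≡ pow w n ++ v ++ u′) × InStars ps u′

InL : {p : ℕ} → Word p → List (Word p × Word p) → Word p → Set
InL v₀ ps u = Σ (Word _) λ u′ → (u ≡ v₀ ++ u′) × InStars ps u′

valSet : (p : ℕ) → Word p → List (Word p × Word p) → ℕ → Set
valSet p v₀ ps m = Σ (Word p) λ u → InL v₀ ps u × val p u ≡ m

Vp : ℕ → ℕ → ℕ → Set
Vp p a b = (b ≢ 0) × (Σ ℕ λ k → a ≡ p ^ k) × (a ∣ b) × ¬ (p * a ∣ b)

data Term (n : ℕ) : Set where
  var  : Fin n → Term n
  zero one : Term n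
  _⊕_  : Term n → Term n → Term n

data QF (n : ℕ) : Set where
  _≐_   : Term n → Term n → QF n
  V     : Term n → Term n → QF n
  ¬'_   : QF n → QF n
  _∧'_  : QF n → QF n → QF n
  _∨'_  : QF n → QF n → QF n

evalT : {n : ℕ} → (Fin n → ℕ) → Term n → ℕ
evalT ρ (var i) = ρ i
evalT ρ zero    = 0
evalT ρ one     = 1
evalT ρ (s ⊕ t) = evalT ρ s + evalT ρ t

Sat : {n : ℕ} → ℕ → (Fin n → ℕ) → QF n → Set
Sat p ρ (s ≐ t)  = evalT ρ s ≡ evalT ρ t
Sat p ρ (V s t)  = Vp p (evalT ρ s) (evalT ρ t)
Sat p ρ (¬' φ)   = ¬ Sat p ρ φ
Sat p ρ (φ ∧' ψ) = Sat p ρ φ × Sat p ρ ψ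
Sat p ρ (φ ∨' ψ) = Sat p ρ φ ⊎ Sat p ρ ψ

_∷ᵉ_ : {m : ℕ} → ℕ → (Fin m → ℕ) → Fin (suc m) → ℕ
(x ∷ᵉ ρ) Fin.zero    = x
(x ∷ᵉ ρ) (Fin.suc i) = ρ i

-- M ⊆ ℕ is definable in existential Büchi arithmetic of base p:
-- M = { x : ∃ y₁ … y_m . φ(x, y₁,…,y_m) } with φ quantifier-free
-- (variable 0 of φ is the free variable x, variables 1…m are the y's).
ExDefinable : ℕ → (ℕ → Set) → Set
ExDefinable p M =
  Σ ℕ λ m → Σ (QF (suc m)) λ φ →
    (x : ℕ) → M x ⇔ (Σ (Fin m → ℕ) λ ρ → Sat p (x ∷ᵉ ρ) φ)

-- A word u is tracked by the pair (⟦u⟧, p^|u|); the length is needed because leading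
-- zeros make it invisible in ⟦u⟧. The language is built from {ε} by prefixing fixed words v,
-- which act on the pair linearly, and by prefixing stars w^*. For w ≠ ε put m = p^|w| − 1
-- and c = ⟦w⟧. Given the pair (S, R) of u, the pairs (x, y) of the words w^k u are cut out
-- by V_p(y, y), y = R + m t and m x + c R = c y + m S. Since p is coprime to m and has
-- order |w| modulo m, the first two conditions say exactly y = R p^(k|w|), and then the last
-- one says x = ⟦w^k⟧ R + S, by the geometric series ⟦w^k⟧ m = c (p^(k|w|) − 1).

module Submission where

open import Defs
open import Data.Nat using (ℕ; zero; suc; pred; _+_; _*_; _^_; _≤_; _<_; z<s; NonZero; >-nonZero)
open import Data.Nat.Properties
open import Data.Nat.Divisibility using (_∣_; divides; ∣-trans; ∣1⇒≡1; ∣m+n∣m⇒∣n; quotient; m∣n⇒n≡quotient*m; m∣n⇒n≡m*quotient; m∣m*n; >⇒∤; ∣-refl)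
open import Data.Nat.Coprimality using (Coprime; coprime-divisor)
open import Data.Nat.DivMod using (_/_; _%_; m≡m%n+[m/n]*n; m%n<n)
open import Data.Nat.Solver using (module +-*-Solver)
open import Data.Fin using (Fin; toℕ; _↑ʳ_)
open import Data.List using (List; []; _∷_; _++_; foldl; length)
open import Data.List.Properties using (foldl-++; length-++)
open import Data.Product using (Σ; ∃-syntax; _×_; _,_; proj₁; proj₂)
open import Data.Product.Function.NonDependent.Propositional using (_×-⇔_)
open import Data.Sum using (inj₁; inj₂)
open import Data.Sum.Function.Propositional using (_⊎-⇔_)
open import Data.Empty using (⊥-elim)
open import Function using (_∘_)
open import Function.Bundles using (_⇔_; mk⇔; Equivalence)
import Function.Properties.Equivalence as ⇔
open import Relation.Binary.PropositionalEquality

open +-*-Solver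
open Equivalence using (to; from)

coprime-^ : ∀ {m n} → Coprime m n → ∀ k → Coprime m (n ^ k)
coprime-^ m⊥n zero    (_ , d∣1)         = ∣1⇒≡1 d∣1
coprime-^ m⊥n (suc k) {d} (d∣m , d∣nnᵏ) = coprime-^ m⊥n k (d∣m , coprime-divisor d⊥n d∣nnᵏ)
  where
  d⊥n : Coprime d _
  d⊥n (e∣d , e∣n) = m⊥n (∣-trans e∣d d∣m , e∣n)

p^L≡1+m⇒coprime : ∀ {p m} ℓ → p ^ suc ℓ ≡ suc m → Coprime m p
p^L≡1+m⇒coprime {p} {m} ℓ pᴸ≡1+m {d} (d∣m , d∣p) = ∣1⇒≡1 (∣m+n∣m⇒∣n d∣m+1 d∣m)
  where
  d∣m+1 : d ∣ m + 1
  d∣m+1 = subst (d ∣_) (trans pᴸ≡1+m (+-comm 1 m)) (∣-trans d∣p (m∣m*n (p ^ ℓ)))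

p^L≡1+m⇒p^[k*L]≡1+m*s : ∀ {p L m} → p ^ L ≡ suc m → ∀ k → ∃[ s ] p ^ (k * L) ≡ suc (m * s)
p^L≡1+m⇒p^[k*L]≡1+m*s {m = m} _ zero = 0 , cong suc (sym (*-zeroʳ m))
p^L≡1+m⇒p^[k*L]≡1+m*s {p} {L} {m} pᴸ≡1+m (suc k) with p^L≡1+m⇒p^[k*L]≡1+m*s pᴸ≡1+m k
... | s , pᵏᴸ≡1+ms = s + suc (m * s) , (begin
  p ^ (L + k * L)      ≡⟨ ^-distribˡ-+-* p L (k * L) ⟩
  p ^ L * p ^ (k * L)  ≡⟨ cong₂ _*_ pᴸ≡1+m pᵏᴸ≡1+ms ⟩
  suc m * suc (m * s)  ≡⟨ solve 2 (λ m s → (con 1 :+ m) :* (con 1 :+ m :* s)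
                                  := con 1 :+ m :* (s :+ (con 1 :+ m :* s))) refl m s ⟩
  suc (m * (s + suc (m * s))) ∎)
  where open ≡-Reasoning

module _ {p : ℕ} where

  val-acc : ∀ acc (u : Word p) → foldl (λ acc d → acc * p + toℕ d) acc u ≡ acc * p ^ length u + val p u
  val-acc acc []      = sym (trans (+-identityʳ _) (*-identityʳ acc))
  val-acc acc (d ∷ u) = begin
    foldl _ (acc * p + toℕ d) u                   ≡⟨ val-acc (acc * p + toℕ d) u ⟩
    (acc * p + toℕ d) * p ^ length u + val p u    ≡⟨ solve 5 (λ a p d P V → (a :* p :+ d) :* P :+ V
                                                         := a :* (p :* P) :+ (d :* P :+ V)) refl acc p (toℕ d) (p ^ length u) (val p u) ⟩
    acc * p ^ length (d ∷ u) + (toℕ d * p ^ length u + val p u)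
                                                  ≡⟨ cong (acc * p ^ length (d ∷ u) +_) (sym (val-acc (toℕ d) u)) ⟩
    acc * p ^ length (d ∷ u) + val p (d ∷ u)      ∎
    where open ≡-Reasoning

  val-++ : ∀ (u v : Word p) → val p (u ++ v) ≡ val p u * p ^ length v + val p v
  val-++ u v = trans (foldl-++ _ 0 u v) (val-acc (val p u) v)

  length-pow : ∀ (w : Word p) n → length (pow w n) ≡ n * length w
  length-pow w zero    = refl
  length-pow w (suc n) = trans (length-++ w) (cong (length w +_) (length-pow w n))

  length-pow-++ : ∀ (w u : Word p) n → length (pow w n ++ u) ≡ n * length w + length u
  length-pow-++ w u n = trans (length-++ (pow w n)) (cong (_+ length u) (length-pow w n))

  ^-length-pow-++ : ∀ (w u : Word p) n → p ^ length (pow w n ++ u) ≡ p ^ (n * length w) * p ^ length u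
  ^-length-pow-++ w u n = trans (cong (p ^_) (length-pow-++ w u n)) (^-distribˡ-+-* p (n * length w) (length u))

  pow-[] : ∀ n → pow {p} [] n ≡ []
  pow-[] zero    = refl
  pow-[] (suc n) = pow-[] n

  val-pow : ∀ (w : Word p) {m} → p ^ length w ≡ suc m → ∀ n →
            val p (pow w n) * m + val p w ≡ val p w * p ^ (n * length w)
  val-pow w {m} _       zero    = sym (*-identityʳ (val p w))
  val-pow w {m} pᴸ≡1+m (suc n) = begin
    val p (w ++ pow w n) * m + c               ≡⟨ cong (λ x → x * m + c) (val-++ w (pow w n)) ⟩
    (c * p ^ length (pow w n) + W) * m + c      ≡⟨ cong (λ ℓ → (c * p ^ ℓ + W) * m + c) (length-pow w n) ⟩
    (c * Q + W) * m + c                         ≡⟨ solve 4 (λ c Q W m → (c :* Q :+ W) :* m :+ c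
                                                       := c :* Q :* m :+ (W :* m :+ c)) refl c Q W m ⟩
    c * Q * m + (W * m + c)                     ≡⟨ cong (c * Q * m +_) (val-pow w pᴸ≡1+m n) ⟩
    c * Q * m + c * Q                           ≡⟨ solve 3 (λ c Q m → c :* Q :* m :+ c :* Q
                                                       := c :* ((con 1 :+ m) :* Q)) refl c Q m ⟩
    c * (suc m * Q)                             ≡⟨ cong (λ x → c * (x * Q)) (sym pᴸ≡1+m) ⟩
    c * (p ^ length w * Q)                      ≡⟨ cong (c *_) (sym (^-distribˡ-+-* p (length w) (n * length w))) ⟩
    c * p ^ (suc n * length w)                  ∎
    where
    open ≡-Reasoning
    c W Q : ℕ
    c = val p w
    W = val p (pow w n)
    Q = p ^ (n * length w)

  val-pow-++ : ∀ (w u : Word p) {m} → p ^ length w ≡ suc m → ∀ k →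
               m * val p (pow w k ++ u) + val p w * p ^ length u ≡
               val p w * p ^ length (pow w k ++ u) + m * val p u
  val-pow-++ w u {m} pᴸ≡1+m k = begin
    m * val p (pow w k ++ u) + c * P   ≡⟨ cong (λ x → m * x + c * P) (val-++ (pow w k) u) ⟩
    m * (W * P + Y) + c * P            ≡⟨ solve 5 (λ m c W Y P → m :* (W :* P :+ Y) :+ c :* P
                                              := (W :* m :+ c) :* P :+ m :* Y) refl m c W Y P ⟩
    (W * m + c) * P + m * Y            ≡⟨ cong (λ x → x * P + m * Y) (val-pow w pᴸ≡1+m k) ⟩
    c * Q * P + m * Y                  ≡⟨ cong (_+ m * Y) (*-assoc c Q P) ⟩
    c * (Q * P) + m * Y                ≡⟨ cong (λ x → c * x + m * Y) (sym (^-length-pow-++ w u k)) ⟩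
    c * p ^ length (pow w k ++ u) + m * Y ∎
    where
    open ≡-Reasoning
    c W Y P Q : ℕ
    c = val p w
    W = val p (pow w k)
    Y = val p u
    P = p ^ length u
    Q = p ^ (k * length w)

renameT : ∀ {n n′} → (Fin n → Fin n′) → Term n → Term n′
renameT f (var i) = var (f i)
renameT f zero    = zero
renameT f one     = one
renameT f (s ⊕ t) = renameT f s ⊕ renameT f t

rename : ∀ {n n′} → (Fin n → Fin n′) → QF n → QF n′
rename f (s ≐ t)  = renameT f s ≐ renameT f t
rename f (V s t)  = V (renameT f s) (renameT f t)
rename f (¬' φ)   = ¬' rename f φ
rename f (φ ∧' ψ) = rename f φ ∧' rename f ψ
rename f (φ ∨' ψ) = rename f φ ∨' rename f ψ

evalT-rename : ∀ {n n′} (f : Fin n → Fin n′) (ρ : Fin n′ → ℕ) t → evalT ρ (renameT f t) ≡ evalT (ρ ∘ f) t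
evalT-rename f ρ (var i) = refl
evalT-rename f ρ zero    = refl
evalT-rename f ρ one     = refl
evalT-rename f ρ (s ⊕ t) = cong₂ _+_ (evalT-rename f ρ s) (evalT-rename f ρ t)

Sat-rename : ∀ {p n n′} (f : Fin n → Fin n′) (ρ : Fin n′ → ℕ) φ → Sat p ρ (rename f φ) ⇔ Sat p (ρ ∘ f) φ
Sat-rename f ρ (s ≐ t) rewrite evalT-rename f ρ s | evalT-rename f ρ t = ⇔.refl
Sat-rename f ρ (V s t) rewrite evalT-rename f ρ s | evalT-rename f ρ t = ⇔.refl
Sat-rename f ρ (¬' φ)   = mk⇔ (λ ¬sat sat → ¬sat (from (Sat-rename f ρ φ) sat))
                              (λ ¬sat sat → ¬sat (to (Sat-rename f ρ φ) sat))
Sat-rename f ρ (φ ∧' ψ) = Sat-rename f ρ φ ×-⇔ Sat-rename f ρ ψ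
Sat-rename f ρ (φ ∨' ψ) = Sat-rename f ρ φ ⊎-⇔ Sat-rename f ρ ψ

infixr 25 _*ₜ_

_*ₜ_ : ∀ {n} → ℕ → Term n → Term n
zero  *ₜ t = zero
suc k *ₜ t = t ⊕ k *ₜ t

evalT-*ₜ : ∀ {n} (ρ : Fin n → ℕ) k t → evalT ρ (k *ₜ t) ≡ k * evalT ρ t
evalT-*ₜ ρ zero    t = refl
evalT-*ₜ ρ (suc k) t = cong (evalT ρ t +_) (evalT-*ₜ ρ k t)

Encodes : (p : ℕ) → ℕ → ℕ → Word p → Set
Encodes p S R u = S ≡ val p u × R ≡ p ^ length u

record Encoding (p : ℕ) (L : Word p → Set) : Set where
  field
    arity    : ℕ
    formula  : QF arity
    valueT   : Term arity
    shiftT   : Term arity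
    sound    : ∀ ρ → Sat p ρ formula → ∃[ u ] L u × Encodes p (evalT ρ valueT) (evalT ρ shiftT) u
    complete : ∀ {u} → L u → ∃[ ρ ] Sat p ρ formula × Encodes p (evalT ρ valueT) (evalT ρ shiftT) u

Prefixed : ∀ {p} → Word p → (Word p → Set) → Word p → Set
Prefixed v L u = Σ (Word _) λ u′ → (u ≡ v ++ u′) × L u′

Starred : ∀ {p} → Word p → (Word p → Set) → Word p → Set
Starred w L u = Σ ℕ λ n → Prefixed (pow w n) L u

Encoding-⇔ : ∀ {p} {L L′ : Word p → Set} → (∀ u → L u ⇔ L′ u) → Encoding p L → Encoding p L′
Encoding-⇔ L⇔L′ E = record
  { arity    = arity
  ; formula  = formula
  ; valueT   = valueT
  ; shiftT   = shiftT
  ; sound    = λ ρ sat → let (u , Lu , enc) = sound ρ sat in u , to (L⇔L′ u) Lu , enc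
  ; complete = λ {u} L′u → complete (from (L⇔L′ u) L′u)
  }
  where open Encoding E

ε-Encoding : ∀ {p} → Encoding p (_≡ [])
ε-Encoding = record
  { arity    = 0
  ; formula  = zero ≐ zero
  ; valueT   = zero
  ; shiftT   = one
  ; sound    = λ _ _ → [] , refl , refl , refl
  ; complete = λ { refl → (λ ()) , refl , refl , refl }
  }

Encodes-++ : ∀ {p S R u} (v : Word p) → Encodes p S R u → Encodes p (val p v * R + S) (p ^ length v * R) (v ++ u)
Encodes-++ {p} {u = u} v (refl , refl) =
  sym (val-++ v u) , trans (sym (^-distribˡ-+-* p (length v) (length u))) (cong (p ^_) (sym (length-++ v)))

Prefixed-Encoding : ∀ {p} {L : Word p → Set} (v : Word p) → Encoding p L → Encoding p (Prefixed v L)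
Prefixed-Encoding {p} v E = record
  { arity    = arity
  ; formula  = formula
  ; valueT   = (val p v *ₜ shiftT) ⊕ valueT
  ; shiftT   = (p ^ length v) *ₜ shiftT
  ; sound    = λ ρ sat → let (u , Lu , enc) = sound ρ sat in v ++ u , (u , refl , Lu) , prefix ρ enc
  ; complete = λ { (u , refl , Lu) → let (ρ , sat , enc) = complete Lu in ρ , sat , prefix ρ enc }
  }
  where
  open Encoding E
  prefix : ∀ ρ {u} → Encodes p (evalT ρ valueT) (evalT ρ shiftT) u →
           Encodes p (evalT ρ ((val p v *ₜ shiftT) ⊕ valueT)) (evalT ρ ((p ^ length v) *ₜ shiftT)) (v ++ u)
  prefix ρ rewrite evalT-*ₜ ρ (val p v) shiftT | evalT-*ₜ ρ (p ^ length v) shiftT = Encodes-++ v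

Encoding⇒ExDefinable : ∀ {p} {L : Word p → Set} → Encoding p L → ExDefinable p (λ x → ∃[ u ] L u × val p u ≡ x)
Encoding⇒ExDefinable {p} {L} E = arity , φ , λ x → mk⇔ (satisfiable x) (realised x)
  where
  open Encoding E
  φ : QF (suc arity)
  φ = (var Fin.zero ≐ renameT Fin.suc valueT) ∧' rename Fin.suc formula
  satisfiable : ∀ x → ∃[ u ] L u × val p u ≡ x → ∃[ ρ ] Sat p (x ∷ᵉ ρ) φ
  satisfiable x (u , Lu , refl) = let (ρ , sat , enc) = complete Lu in
    ρ , trans (sym (proj₁ enc)) (sym (evalT-rename Fin.suc (x ∷ᵉ ρ) valueT)) , from (Sat-rename Fin.suc (x ∷ᵉ ρ) formula) sat
  realised : ∀ x → ∃[ ρ ] Sat p (x ∷ᵉ ρ) φ → ∃[ u ] L u × val p u ≡ x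
  realised x (ρ , x≡ , sat) = let (u , Lu , enc) = sound ρ (to (Sat-rename Fin.suc (x ∷ᵉ ρ) formula) sat) in
    u , Lu , sym (trans x≡ (trans (evalT-rename Fin.suc (x ∷ᵉ ρ) valueT) (proj₁ enc)))

StarStep : (p m c S R x y t : ℕ) → Set
StarStep p m c S R x y t = Vp p y y × y ≡ R + m * t × m * x + c * R ≡ c * y + m * S

starStep : ∀ {n} (m c : ℕ) (S R x y t : Term n) → QF n
starStep m c S R x y t = V y y ∧' ((y ≐ (R ⊕ m *ₜ t)) ∧' ((m *ₜ x ⊕ c *ₜ R) ≐ (c *ₜ y ⊕ m *ₜ S)))

Sat-starStep : ∀ {p n} (ρ : Fin n → ℕ) m c S R x y t →
               Sat p ρ (starStep m c S R x y t) ⇔ StarStep p m c (evalT ρ S) (evalT ρ R) (evalT ρ x) (evalT ρ y) (evalT ρ t)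
Sat-starStep ρ m c S R x y t
  rewrite evalT-*ₜ ρ m t | evalT-*ₜ ρ m x | evalT-*ₜ ρ c R | evalT-*ₜ ρ c y | evalT-*ₜ ρ m S = ⇔.refl

module _ {p : ℕ} (1<p : 1 < p) where

  instance
    p≢0 : NonZero p
    p≢0 = >-nonZero (<-trans z<s 1<p)

  p^r≡1⇒r≡0 : ∀ {r} → p ^ r ≡ 1 → r ≡ 0
  p^r≡1⇒r≡0 {r} pʳ≡1 with m^n≡1⇒n≡0∨m≡1 p r pʳ≡1
  ... | inj₁ r≡0 = r≡0
  ... | inj₂ p≡1 = ⊥-elim (<-irrefl (sym p≡1) 1<p)

  p^d≡1+m*t⇒L∣d : ∀ {ℓ m d t} → p ^ suc ℓ ≡ suc m → p ^ d ≡ suc (m * t) → suc ℓ ∣ d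
  p^d≡1+m*t⇒L∣d {ℓ} {m} {d} {t} pᴸ≡1+m pᵈ≡1+mt = divides (d / L) (begin
    d                   ≡⟨ m≡m%n+[m/n]*n d L ⟩
    d % L + d / L * L   ≡⟨ cong (_+ d / L * L) r≡0 ⟩
    d / L * L           ∎)
    where
    open ≡-Reasoning
    L r s f : ℕ
    L = suc ℓ
    r = d % L
    s = proj₁ (p^L≡1+m⇒p^[k*L]≡1+m*s pᴸ≡1+m (d / L))
    f = pred (p ^ r)
    1+f≡pʳ : suc f ≡ p ^ r
    1+f≡pʳ = suc-pred (p ^ r) {{m^n≢0 p r}}
    mt≡m[pʳs]+f : m * t ≡ m * (p ^ r * s) + f
    mt≡m[pʳs]+f = suc-injective (begin
      suc (m * t)                ≡⟨ sym pᵈ≡1+mt ⟩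
      p ^ d                      ≡⟨ cong (p ^_) (m≡m%n+[m/n]*n d L) ⟩
      p ^ (r + d / L * L)        ≡⟨ ^-distribˡ-+-* p r (d / L * L) ⟩
      p ^ r * p ^ (d / L * L)    ≡⟨ cong₂ _*_ (sym 1+f≡pʳ) (proj₂ (p^L≡1+m⇒p^[k*L]≡1+m*s pᴸ≡1+m (d / L))) ⟩
      suc f * suc (m * s)        ≡⟨ solve 3 (λ f m s → (con 1 :+ f) :* (con 1 :+ m :* s)
                                         := con 1 :+ (m :* ((con 1 :+ f) :* s) :+ f)) refl f m s ⟩
      suc (m * (suc f * s) + f)  ≡⟨ cong (λ x → suc (m * (x * s) + f)) 1+f≡pʳ ⟩
      suc (m * (p ^ r * s) + f)  ∎)
    f<m : f < m
    f<m = ≤-pred (subst₂ _<_ (sym 1+f≡pʳ) pᴸ≡1+m (^-monoʳ-< p 1<p (m%n<n d L)))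
    f≡0 : f ≡ 0
    f≡0 with f | f<m | ∣m+n∣m⇒∣n (subst (m ∣_) mt≡m[pʳs]+f (m∣m*n t)) (m∣m*n (p ^ r * s))
    ... | zero  | _   | _   = refl
    ... | suc _ | f<m | m∣f = ⊥-elim (>⇒∤ f<m m∣f)
    r≡0 : r ≡ 0
    r≡0 = p^r≡1⇒r≡0 (trans (sym 1+f≡pʳ) (cong suc f≡0))

  p^a≡p^b+m*t⇒a≡k*L+b : ∀ {ℓ m a b t} → p ^ suc ℓ ≡ suc m →
           p ^ a ≡ p ^ b + m * t → ∃[ k ] a ≡ k * suc ℓ + b
  p^a≡p^b+m*t⇒a≡k*L+b {ℓ} {m} {a} {b} {t} pᴸ≡1+m pᵃ≡pᵇ+mt = k , (begin
    a              ≡⟨ sym b+d≡a ⟩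
    b + d          ≡⟨ cong (b +_) (m∣n⇒n≡quotient*m sucℓ∣d) ⟩
    b + k * suc ℓ  ≡⟨ +-comm b (k * suc ℓ) ⟩
    k * suc ℓ + b  ∎)
    where
    open ≡-Reasoning
    b≤a : b ≤ a
    b≤a = ≮⇒≥ λ a<b → <⇒≱ (^-monoʳ-< p 1<p a<b) (subst (p ^ b ≤_) (sym pᵃ≡pᵇ+mt) (m≤m+n (p ^ b) (m * t)))
    d e k : ℕ
    d = proj₁ (m≤n⇒∃[o]m+o≡n b≤a)
    b+d≡a : b + d ≡ a
    b+d≡a = proj₂ (m≤n⇒∃[o]m+o≡n b≤a)
    e = pred (p ^ d)
    1+e≡pᵈ : suc e ≡ p ^ d
    1+e≡pᵈ = suc-pred (p ^ d) {{m^n≢0 p d}}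
    pᵇe≡mt : p ^ b * e ≡ m * t
    pᵇe≡mt = +-cancelˡ-≡ (p ^ b) _ _ (begin
      p ^ b + p ^ b * e  ≡⟨ sym (*-suc (p ^ b) e) ⟩
      p ^ b * suc e      ≡⟨ cong (p ^ b *_) 1+e≡pᵈ ⟩
      p ^ b * p ^ d      ≡⟨ sym (^-distribˡ-+-* p b d) ⟩
      p ^ (b + d)        ≡⟨ cong (p ^_) b+d≡a ⟩
      p ^ a              ≡⟨ pᵃ≡pᵇ+mt ⟩
      p ^ b + m * t      ∎)
    m∣e : m ∣ e
    m∣e = coprime-divisor (coprime-^ (p^L≡1+m⇒coprime ℓ pᴸ≡1+m) b) (divides t (trans pᵇe≡mt (*-comm m t)))
    sucℓ∣d : suc ℓ ∣ d
    sucℓ∣d = p^d≡1+m*t⇒L∣d pᴸ≡1+m (begin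
      p ^ d              ≡⟨ sym 1+e≡pᵈ ⟩
      suc e              ≡⟨ cong suc (m∣n⇒n≡m*quotient m∣e) ⟩
      suc (m * quotient m∣e) ∎)
    k = quotient sucℓ∣d

  Vp-^ : ∀ a → Vp p (p ^ a) (p ^ a)
  Vp-^ a = m<n⇒n≢0 (m^n>0 p a) , (a , refl) , ∣-refl ,
           >⇒∤ {{m^n≢0 p a}} (subst (p ^ a <_) (*-comm (p ^ a) p) (m<m*n (p ^ a) p {{m^n≢0 p a}} 1<p))

  modulus : Word p → ℕ
  modulus w = pred (p ^ length w)

  p^∣w∣≡1+modulus : ∀ w → p ^ length w ≡ suc (modulus w)
  p^∣w∣≡1+modulus w = sym (suc-pred (p ^ length w) {{m^n≢0 p (length w)}})

  modulus-nonZero : ∀ d w → NonZero (modulus (d ∷ w))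
  modulus-nonZero d w = >-nonZero (≤-pred (subst (1 <_) (p^∣w∣≡1+modulus (d ∷ w)) (^-monoʳ-< p 1<p {0} {length (d ∷ w)} z<s)))

  StarStep-complete : ∀ {S R} (w u : Word p) k → Encodes p S R u →
    ∃[ t ] StarStep p (modulus w) (val p w) S R (val p (pow w k ++ u)) (p ^ length (pow w k ++ u)) t
  StarStep-complete w u k (refl , refl) =
    P * s , Vp-^ (length (pow w k ++ u)) , y≡P+m[Ps] , val-pow-++ w u (p^∣w∣≡1+modulus w) k
    where
    open ≡-Reasoning
    m P s : ℕ
    m = modulus w
    P = p ^ length u
    s = proj₁ (p^L≡1+m⇒p^[k*L]≡1+m*s (p^∣w∣≡1+modulus w) k)
    y≡P+m[Ps] : p ^ length (pow w k ++ u) ≡ P + m * (P * s)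
    y≡P+m[Ps] = begin
      p ^ length (pow w k ++ u)   ≡⟨ ^-length-pow-++ w u k ⟩
      p ^ (k * length w) * P      ≡⟨ cong (_* P) (proj₂ (p^L≡1+m⇒p^[k*L]≡1+m*s (p^∣w∣≡1+modulus w) k)) ⟩
      suc (m * s) * P             ≡⟨ solve 3 (λ m s P → (con 1 :+ m :* s) :* P := P :+ m :* (P :* s)) refl m s P ⟩
      P + m * (P * s)             ∎

  StarStep-sound : ∀ {S R x y t} d w u → Encodes p S R u →
    StarStep p (modulus (d ∷ w)) (val p (d ∷ w)) S R x y t → ∃[ k ] Encodes p x y (pow (d ∷ w) k ++ u)
  StarStep-sound {x = x} d w u (refl , refl) ((_ , (a , refl) , _) , pᵃ≡P+mt , lin) = k , x≡ , pᵃ≡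
    where
    w⁺ : Word p
    w⁺ = d ∷ w
    m c k : ℕ
    m = modulus w⁺
    c = val p w⁺
    exponent : ∃[ k ] a ≡ k * length w⁺ + length u
    exponent = p^a≡p^b+m*t⇒a≡k*L+b (p^∣w∣≡1+modulus w⁺) pᵃ≡P+mt
    k = proj₁ exponent
    pᵃ≡ : p ^ a ≡ p ^ length (pow w⁺ k ++ u)
    pᵃ≡ = cong (p ^_) (trans (proj₂ exponent) (sym (length-pow-++ w⁺ u k)))
    x≡ : x ≡ val p (pow w⁺ k ++ u)
    x≡ = *-cancelˡ-≡ x _ m {{modulus-nonZero d w}} (+-cancelʳ-≡ (c * p ^ length u) _ _ (begin
      m * x + c * p ^ length u                        ≡⟨ lin ⟩
      c * p ^ a + m * val p u                         ≡⟨ cong (λ y → c * y + m * val p u) pᵃ≡ ⟩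
      c * p ^ length (pow w⁺ k ++ u) + m * val p u    ≡⟨ sym (val-pow-++ w⁺ u (p^∣w∣≡1+modulus w⁺) k) ⟩
      m * val p (pow w⁺ k ++ u) + c * p ^ length u    ∎))
      where open ≡-Reasoning

  Starred-Encoding : ∀ {L : Word p → Set} (w : Word p) → Encoding p L → Encoding p (Starred w L)
  Starred-Encoding {L} [] = Encoding-⇔ λ u → mk⇔ (λ Lu → 0 , u , refl , Lu) λ where
    (n , u′ , refl , Lu′) → subst L (cong (_++ u′) (sym (pow-[] n))) Lu′
  Starred-Encoding {L} (d ∷ w) E = record
    { arity    = 3 + arity
    ; formula  = formula′
    ; valueT   = x
    ; shiftT   = y
    ; sound    = sound′
    ; complete = complete′
    }
    where
    open Encoding E
    m c : ℕ
    m = modulus (d ∷ w)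
    c = val p (d ∷ w)
    x y t S′ R′ : Term (3 + arity)
    x  = var Fin.zero
    y  = var (Fin.suc Fin.zero)
    t  = var (Fin.suc (Fin.suc Fin.zero))
    S′ = renameT (3 ↑ʳ_) valueT
    R′ = renameT (3 ↑ʳ_) shiftT
    formula′ : QF (3 + arity)
    formula′ = rename (3 ↑ʳ_) formula ∧' starStep m c S′ R′ x y t
    step⇔ : ∀ ρ → Sat p ρ (starStep m c S′ R′ x y t) ⇔
                  StarStep p m c (evalT (ρ ∘ (3 ↑ʳ_)) valueT) (evalT (ρ ∘ (3 ↑ʳ_)) shiftT)
                           (evalT ρ x) (evalT ρ y) (evalT ρ t)
    step⇔ ρ rewrite sym (evalT-rename (3 ↑ʳ_) ρ valueT) | sym (evalT-rename (3 ↑ʳ_) ρ shiftT) =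
      Sat-starStep ρ m c S′ R′ x y t
    sound′ : ∀ ρ → Sat p ρ formula′ → ∃[ u ] Starred (d ∷ w) L u × Encodes p (evalT ρ x) (evalT ρ y) u
    sound′ ρ (sat , step) =
      let (u , Lu , enc) = sound (ρ ∘ (3 ↑ʳ_)) (to (Sat-rename (3 ↑ʳ_) ρ formula) sat)
          (k , enc′)     = StarStep-sound d w u enc (to (step⇔ ρ) step)
      in pow (d ∷ w) k ++ u , (k , u , refl , Lu) , enc′
    complete′ : ∀ {u} → Starred (d ∷ w) L u → ∃[ ρ ] Sat p ρ formula′ × Encodes p (evalT ρ x) (evalT ρ y) u
    complete′ (k , u , refl , Lu) =
      let (ρ′ , sat , enc) = complete Lu
          (t′ , step)      = StarStep-complete (d ∷ w) u k enc
          ρ                = val p (pow (d ∷ w) k ++ u) ∷ᵉ ((p ^ length (pow (d ∷ w) k ++ u)) ∷ᵉ (t′ ∷ᵉ ρ′))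
      in ρ , (from (Sat-rename (3 ↑ʳ_) ρ formula) sat , from (step⇔ ρ) step) , refl , refl

  InStars-Encoding : (ps : List (Word p × Word p)) → Encoding p (InStars ps)
  InStars-Encoding []             = ε-Encoding
  InStars-Encoding ((w , v) ∷ ps) = Encoding-⇔ unnest (Starred-Encoding w (Prefixed-Encoding v (InStars-Encoding ps)))
    where
    unnest : ∀ u → Starred w (Prefixed v (InStars ps)) u ⇔ InStars ((w , v) ∷ ps) u
    unnest u = mk⇔ (λ { (n , _ , refl , u′ , refl , Lu′) → n , u′ , refl , Lu′ })
                   (λ { (n , u′ , refl , Lu′) → n , v ++ u′ , refl , u′ , refl , Lu′ })

proposition2 : (p : ℕ) → 2 ≤ p → (v₀ : Word p) → (ps : List (Word p × Word p)) →
    ExDefinable p (valSet p v₀ ps)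
proposition2 p 1<p v₀ ps = Encoding⇒ExDefinable (Prefixed-Encoding v₀ (InStars-Encoding 1<p ps))
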